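{- Fix an integer $d\ge 1$ and consider the $d$-dimensional Parallel Random Apollonian Network (P-RAN) process described in the context. For each integer $m\ge 0$ and each time $t\ge 0$, let $Nc_t(m)$ be the number of $(d+1)$-cliques in $\mathcal{C}_t$ whose parallel degree at time $t$ equals $m$. Then for every $m\ge 0$, $$\lim_{t\to\infty}\frac{\mathbb{E}[Nc_t(m)]}{d+2+(d+1)t}=\frac{d+1}{(d+2)^{m+1}},$$ i.e. asymptotically the parallel degree of a uniformly chosen $(d+1)$-clique of $\mathcal{C}_t$ follows the geometric distribution $Pc(m)=\frac{d+1}{(d+2)^{m+1}}$, $m=0,1,2,\dots$
   Context: The $d$-dimensional P-RAN process: at time $t=0$ the graph $G_0$ is the complete graph on $d+2$ vertices, and $\mathcal{C}_0$ is the set of its $d+2$ vertex subsets of size $d+1$ (its $(d+1)$-cliques). For each $t\ge 1$, a clique $c$ is chosen uniformly at random from $\mathcal{C}_{t-1}$ (independently of the past given the current state); a new vertex $v$ is added to the graph and joined by edges to all $d+1$ vertices of $c$, giving $G_t$; and $\mathcal{C}_t=\mathcal{C}_{t-1}\cup\{(c\setminus\{x\})\cup\{v\}: x\in c\}$ (so $c$ itself remains in $\mathcal{C}_t$ and $d+1$ new cliques are added). Thus $|\mathcal{C}_t|=d+2+(d+1)t$ and $G_t$ has $d+2+t$ vertices. The parallel degree of a clique $c\in\mathcal{C}_t$ at time $t$ is the number of vertices that have been inserted into $c$, i.e. the number of steps $s\in\{1,\dots,t\}$ at which $c$ was the chosen clique (cliques have parallel degree $0$ when they enter $\mathcal{C}$).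 -}

module Defs where

open import Data.Nat using (ℕ; zero; suc; _+_; _*_; _^_; _≟_)
open import Data.Fin using (Fin; toℕ)
open import Data.List using (List; []; _∷_; [_]; _++_; map; concatMap; filter; length; upTo; allFin)
open import Data.Nat.ListAction using (sum)
open import Data.Integer using (+_)
open import Data.Rational using (ℚ; _/_; 0ℚ)
open import Relation.Nullary using (¬_)
open import Relation.Nullary.Decidable using (¬?)

cliqueCount : ℕ → ℕ → ℕ
cliqueCount d t = d + 2 + (d + 1) * t

-- A run of the process up to time t: the sequence of choices.
-- The clique family C_t is kept as a list (insertion order, no duplicates:
-- every new clique contains the new vertex); at step t+1 a position in
-- C_t is chosen, i.e. an element of Fin (cliqueCount d t).
data Choices (d : ℕ) : ℕ → Set where
  []   : Choices d 0
  _∷ʳ_ : ∀ {t} → Choices d t → Fin (cliqueCount d t) → Choices d (suc t)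

-- all runs up to time t (each has probability 1 / #runs, since the choice
-- at each step is uniform on C_{t-1}, whose size is deterministic)
allChoices : (d t : ℕ) → List (Choices d t)
allChoices d zero = [ [] ]
allChoices d (suc t) = concatMap (λ cs → map (cs ∷ʳ_) (allFin (cliqueCount d t))) (allChoices d t)

-- list element at a position (default [] out of range; never used out of range)
at : List (List ℕ) → ℕ → List ℕ
at [] _ = []
at (c ∷ cs) zero = c
at (c ∷ cs) (suc n) = at cs n

-- vertices are 0,1,...; G_0 has vertices 0..d+1, the vertex added at step s is d+1+s
remove : ℕ → List ℕ → List ℕ
remove x = filter (λ y → ¬? (y ≟ x))

cliquesOf : ∀ {d t} → Choices d t → List (List ℕ)
cliquesOf {d} [] = map (λ x → remove x (upTo (d + 2))) (upTo (d + 2))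
cliquesOf {d} {suc t} (cs ∷ʳ i) =
  let C = cliquesOf cs
      c = at C (toℕ i)
      v = d + 2 + t
  in C ++ map (λ x → v ∷ remove x c) c

steps : ∀ {d t} → Choices d t → List ℕ
steps [] = []
steps (cs ∷ʳ i) = toℕ i ∷ steps cs

-- parallel degree of the clique at position j of C_t: number of steps at
-- which it was the chosen clique
pdeg : ∀ {d t} → Choices d t → ℕ → ℕ
pdeg cs j = length (filter (λ s → s ≟ j) (steps cs))

Nc : ∀ {d t} → ℕ → Choices d t → ℕ
Nc m cs = length (filter (λ j → pdeg cs j ≟ m) (upTo (length (cliquesOf cs))))

-- a / n as a rational (n is always positive where used; 0 for n = 0)
frac : ℕ → ℕ → ℚ
frac a zero = 0ℚ
frac a (suc n) = (+ a) / suc n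

-- E[Nc_t(m)] / (d + 2 + (d+1) t), computed exactly: sum of Nc over all
-- equally likely runs, divided by (#runs * |C_t|)
normExpNc : (d t m : ℕ) → ℚ
normExpNc d t m =
  frac (sum (map (Nc m) (allChoices d t)))
       (length (allChoices d t) * cliqueCount d t)

-- A run of length t + 1 extends a run of length t by one of its C_t = d + 2 + (d + 1) t cliques.
-- Summed over these C_t continuations, a clique of parallel degree m keeps its degree in C_t - 1
-- of them, a clique of degree m - 1 reaches degree m in exactly one, and every continuation adds
-- d + 1 cliques of degree 0. So the total S_t(m) of Nc_t(m) over the R_t runs of length t obeys
--   S_{t+1}(m) = (C_t - 1) S_t(m) + S_t(m - 1) + [m = 0] (d + 1) C_t R_t     (S_t(-1) = 0).
-- For p_m = (d + 1) / (d + 2)^(m+1) one has (d + 2) p_m = p_{m-1} and (d + 2) p_0 = d + 1, so the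
-- error e_t(m) = S_t(m) / R_t - p_m C_t satisfies e_{t+1}(m) = ((C_t - 1) e_t(m) + e_t(m - 1)) / C_t.
-- This is a sub-convex combination and |e_0(m)| ≤ 1, hence |e_t(m)| ≤ 1 for all t: the expected
-- proportion of cliques of parallel degree m is within 1 / C_t of p_m.
module Submission where

open import Defs
open import Data.Nat using (ℕ; suc; _+_; _^_; _≥_; _≤_)
open import Data.Product using (∃; Σ)
open import Data.Rational using (ℚ; _<_; _-_; ∣_∣; 0ℚ)

open import Data.Bool using (true; false; if_then_else_)
open import Data.Fin using (toℕ)
import Data.Fin.Properties as Fin
open import Data.Integer as ℤ using (+[1+_]; -[1+_])
import Data.Integer.Properties as ℤ
open import Data.List
  using (List; []; _∷_; _++_; map; filter; length; upTo; applyUpTo; allFin; tabulate; concatMap)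
import Data.List.Properties as List
open import Data.List.Membership.Propositional using (_∈_)
open import Data.List.Membership.Propositional.Properties using (∈-upTo⁺; ∈-upTo⁻)
open import Data.List.Relation.Unary.All as All using (All; []; _∷_)
import Data.List.Relation.Unary.All.Properties as All
open import Data.List.Relation.Unary.AllPairs using (_∷_)
open import Data.List.Relation.Unary.Any using (here; there)
open import Data.List.Relation.Unary.Unique.Propositional using (Unique)
import Data.List.Relation.Unary.Unique.Propositional.Properties as Unique
open import Data.Nat using (zero; _*_; _≟_; z≤n; s≤s; NonZero)
import Data.Nat as ℕ
open import Data.Nat.Coprimality using (Coprime)
open import Data.Nat.ListAction using (sum)
open import Data.Nat.ListAction.Properties using (sum-++)
import Data.Nat.Properties as ℕ
open import Data.Nat.Tactic.RingSolver using (solve-∀)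
open import Data.Product using (_×_; _,_; proj₁; proj₂)
import Data.Rational as ℚ
open import Data.Rational using (mkℚ; toℚᵘ)
import Data.Rational.Properties as ℚ
open import Data.Rational.Unnormalised as ℚᵘ using (mkℚᵘ)
import Data.Rational.Unnormalised.Properties as ℚᵘ
open import Data.Sum using (inj₁; inj₂)
open import Function using (_∘_; const)
open import Relation.Binary.PropositionalEquality
open import Relation.Nullary using (Dec; does; ¬?)
open import Relation.Unary using (Pred; Decidable)

-- Finite sums

𝟙 : {A : Set} → Dec A → ℕ
𝟙 a? = if does a? then 1 else 0

∑< : ℕ → (ℕ → ℕ) → ℕ
∑< n f = sum (map f (upTo n))

syntax ∑< n (λ j → e) = ∑[ j < n ] e

module _ {A : Set} where

  sum-map-+ : ∀ (f g : A → ℕ) xs →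
              sum (map (λ x → f x + g x) xs) ≡ sum (map f xs) + sum (map g xs)
  sum-map-+ f g []       = refl
  sum-map-+ f g (x ∷ xs) = begin
    f x + g x + sum (map (λ x → f x + g x) xs)     ≡⟨ cong (f x + g x +_) (sum-map-+ f g xs) ⟩
    f x + g x + (sum (map f xs) + sum (map g xs))  ≡⟨ interchange (f x) (g x) _ _ ⟩
    f x + sum (map f xs) + (g x + sum (map g xs))  ∎
    where
    open ≡-Reasoning
    interchange : ∀ a b c d → a + b + (c + d) ≡ a + c + (b + d)
    interchange = solve-∀

  sum-map-*ˡ : ∀ c (f : A → ℕ) xs → sum (map (λ x → c * f x) xs) ≡ c * sum (map f xs)
  sum-map-*ˡ c f []       = sym (ℕ.*-zeroʳ c)
  sum-map-*ˡ c f (x ∷ xs) =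
    trans (cong (c * f x +_) (sum-map-*ˡ c f xs)) (sym (ℕ.*-distribˡ-+ c (f x) _))

  sum-map-const : ∀ a (xs : List A) → sum (map (const a) xs) ≡ length xs * a
  sum-map-const a []       = refl
  sum-map-const a (x ∷ xs) = cong (a +_) (sum-map-const a xs)

  length-filter≡sum-𝟙 : ∀ {P : Pred A _} (P? : Decidable P) xs →
                        length (filter P? xs) ≡ sum (map (𝟙 ∘ P?) xs)
  length-filter≡sum-𝟙 P? []       = refl
  length-filter≡sum-𝟙 P? (x ∷ xs) with does (P? x)
  ... | true  = cong suc (length-filter≡sum-𝟙 P? xs)
  ... | false = length-filter≡sum-𝟙 P? xs

  sum-map-update : ∀ {f g : A → ℕ} {i xs} → Unique xs → i ∈ xs →
                   (∀ j → j ≢ i → f j ≡ g j) → sum (map f xs) + g i ≡ sum (map g xs) + f i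
  sum-map-update {f} {g} {xs = y ∷ ys} (y∉ys ∷ _) (here refl) f≗g = begin
    f y + sum (map f ys) + g y  ≡⟨ cong (λ s → f y + s + g y) same-tail ⟩
    f y + sum (map g ys) + g y  ≡⟨ swap (f y) _ (g y) ⟩
    g y + sum (map g ys) + f y  ∎
    where
    open ≡-Reasoning
    same-tail : sum (map f ys) ≡ sum (map g ys)
    same-tail = cong sum (List.map-cong-local (All.map (λ y≢j → f≗g _ (y≢j ∘ sym)) y∉ys))
    swap : ∀ a b c → a + b + c ≡ c + b + a
    swap = solve-∀
  sum-map-update {f} {g} {i} {y ∷ ys} (y∉ys ∷ ys-unique) (there i∈ys) f≗g = begin
    f y + sum (map f ys) + g i    ≡⟨ ℕ.+-assoc (f y) _ (g i) ⟩
    f y + (sum (map f ys) + g i)  ≡⟨ cong₂ _+_ (f≗g y (All.lookup y∉ys i∈ys))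
                                              (sum-map-update ys-unique i∈ys f≗g) ⟩
    g y + (sum (map g ys) + f i)  ≡⟨ ℕ.+-assoc (g y) _ (f i) ⟨
    g y + sum (map g ys) + f i    ∎
    where open ≡-Reasoning

sum-map-concatMap : ∀ {A B : Set} (f : B → ℕ) (g : A → List B) xs →
                    sum (map f (concatMap g xs)) ≡ sum (map (λ x → sum (map f (g x))) xs)
sum-map-concatMap f g []       = refl
sum-map-concatMap f g (x ∷ xs) = begin
  sum (map f (g x ++ concatMap g xs))
    ≡⟨ cong sum (List.map-++ f (g x) _) ⟩
  sum (map f (g x) ++ map f (concatMap g xs))
    ≡⟨ sum-++ (map f (g x)) _ ⟩
  sum (map f (g x)) + sum (map f (concatMap g xs))
    ≡⟨ cong (sum (map f (g x)) +_) (sum-map-concatMap f g xs) ⟩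
  sum (map f (g x)) + sum (map (λ x → sum (map f (g x))) xs) ∎
  where open ≡-Reasoning

length-concatMap : ∀ {A B : Set} (g : A → List B) {n} → (∀ x → length (g x) ≡ n) → ∀ xs →
                   length (concatMap g xs) ≡ length xs * n
length-concatMap g g≡n []       = refl
length-concatMap g g≡n (x ∷ xs) =
  trans (List.length-++ (g x)) (cong₂ _+_ (g≡n x) (length-concatMap g g≡n xs))

applyUpTo-+ : ∀ {A : Set} (f : ℕ → A) m n →
              applyUpTo f (m + n) ≡ applyUpTo f m ++ applyUpTo (f ∘ (m +_)) n
applyUpTo-+ f zero    n = refl
applyUpTo-+ f (suc m) n = cong (f 0 ∷_) (applyUpTo-+ (f ∘ suc) m n)

∑-+ : ∀ m n (f : ℕ → ℕ) → ∑[ j < m + n ] f j ≡ ∑[ j < m ] f j + ∑[ j < n ] f (m + j)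
∑-+ m n f = begin
  sum (map f (upTo (m + n)))                              ≡⟨ cong (sum ∘ map f) (applyUpTo-+ (λ j → j) m n) ⟩
  sum (map f (upTo m ++ applyUpTo (m +_) n))              ≡⟨ cong sum (List.map-++ f (upTo m) _) ⟩
  sum (map f (upTo m) ++ map f (applyUpTo (m +_) n))      ≡⟨ sum-++ (map f (upTo m)) _ ⟩
  ∑< m f + sum (map f (applyUpTo (m +_) n))               ≡⟨ cong (λ xs → ∑< m f + sum xs) shifted ⟩
  ∑< m f + ∑[ j < n ] f (m + j)                           ∎
  where
  open ≡-Reasoning
  shifted : map f (applyUpTo (m +_) n) ≡ map (λ j → f (m + j)) (upTo n)
  shifted = trans (List.map-applyUpTo (m +_) f n) (sym (List.map-upTo (λ j → f (m + j)) n))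

∑-const : ∀ n a → ∑[ j < n ] a ≡ n * a
∑-const n a = trans (sum-map-const a (upTo n)) (cong (_* a) (List.length-upTo n))

tabulate-toℕ : ∀ {A : Set} n (f : ℕ → A) → tabulate {n = n} (f ∘ toℕ) ≡ applyUpTo f n
tabulate-toℕ zero    f = refl
tabulate-toℕ (suc n) f = cong (f 0 ∷_) (tabulate-toℕ n (f ∘ suc))

sum-allFin : ∀ n (f : ℕ → ℕ) → sum (map (f ∘ toℕ) (allFin n)) ≡ ∑[ j < n ] f j
sum-allFin n f = cong sum (trans (List.map-tabulate (λ i → i) (f ∘ toℕ))
                                 (trans (tabulate-toℕ n f) (sym (List.map-upTo f n))))

-- The clique family

length-remove : ∀ {x xs} → x ∈ xs → Unique xs → suc (length (remove x xs)) ≡ length xs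
length-remove {x} {x ∷ ys} (here refl) (x∉ys ∷ _) = begin
  suc (length (remove x (x ∷ ys)))  ≡⟨ cong (suc ∘ length) (List.filter-reject ≢x? (λ x≢x → x≢x refl)) ⟩
  suc (length (remove x ys))        ≡⟨ cong (suc ∘ length) (List.filter-all ≢x? (All.map (_∘ sym) x∉ys)) ⟩
  suc (length ys)                   ∎
  where
  open ≡-Reasoning
  ≢x? = λ y → ¬? (y ≟ x)
length-remove {x} {y ∷ ys} (there x∈ys) (y∉ys ∷ ys-unique) = begin
  suc (length (remove x (y ∷ ys)))  ≡⟨ cong (suc ∘ length) (List.filter-accept ≢x? (All.lookup y∉ys x∈ys)) ⟩
  suc (suc (length (remove x ys)))  ≡⟨ cong suc (length-remove x∈ys ys-unique) ⟩
  suc (length ys)                   ∎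
  where
  open ≡-Reasoning
  ≢x? = λ y → ¬? (y ≟ x)

record IsClique (d n : ℕ) (c : List ℕ) : Set where
  field
    size   : length c ≡ suc d
    unique : Unique c
    bound  : All (ℕ._< n) c

open IsClique

IsClique-weaken : ∀ {d n c} → IsClique d n c → IsClique d (suc n) c
IsClique-weaken c-clique = record
  { size   = size c-clique
  ; unique = unique c-clique
  ; bound  = All.map ℕ.m≤n⇒m≤1+n (bound c-clique)
  }

IsClique-replace : ∀ {d n c x} → IsClique d n c → x ∈ c → IsClique d (suc n) (n ∷ remove x c)
IsClique-replace {d} {n} {c} {x} c-clique x∈c = record
  { size   = cong suc (ℕ.suc-injective (trans (length-remove x∈c (unique c-clique)) (size c-clique)))
  ; unique = All.map (λ y<n n≡y → ℕ.<-irrefl (sym n≡y) y<n) rest-bound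
             ∷ Unique.filter⁺ _ (unique c-clique)
  ; bound  = ℕ.n<1+n n ∷ All.map ℕ.m≤n⇒m≤1+n rest-bound
  }
  where
  rest-bound : All (ℕ._< n) (remove x c)
  rest-bound = All.filter⁺ _ (bound c-clique)

IsClique-initial : ∀ {d x} → x ℕ.< d + 2 → IsClique d (d + 2) (remove x (upTo (d + 2)))
IsClique-initial {d} {x} x<d+2 = record
  { size   = ℕ.suc-injective (trans (length-remove (∈-upTo⁺ x<d+2) (Unique.upTo⁺ (d + 2)))
                                    (trans (List.length-upTo (d + 2)) (ℕ.+-comm d 2)))
  ; unique = Unique.filter⁺ _ (Unique.upTo⁺ (d + 2))
  ; bound  = All.filter⁺ _ (All.tabulate ∈-upTo⁻)
  }

All-at : ∀ {P : List ℕ → Set} cs i → All P cs → i ℕ.< length cs → P (at cs i)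
All-at (c ∷ cs) zero    (pc ∷ _)   _         = pc
All-at (c ∷ cs) (suc i) (_ ∷ pcs)  (s≤s i<n) = All-at cs i pcs i<n

cliqueCount-suc : ∀ d t → cliqueCount d (suc t) ≡ cliqueCount d t + suc d
cliqueCount-suc = polynomial
  where
  polynomial : ∀ d t → d + 2 + (d + 1) * suc t ≡ d + 2 + (d + 1) * t + suc d
  polynomial = solve-∀

cliquesOf-wellFormed : ∀ {d t} (cs : Choices d t) →
  All (IsClique d (d + 2 + t)) (cliquesOf cs) × length (cliquesOf cs) ≡ cliqueCount d t
cliquesOf-wellFormed {d} [] =
  All.map⁺ (All.applyUpTo⁺₁ (λ j → j) (d + 2) λ {x} x<d+2 →
    subst (λ n → IsClique d n (remove x (upTo (d + 2)))) (sym (ℕ.+-identityʳ (d + 2)))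
          (IsClique-initial x<d+2)) ,
  trans (List.length-map _ (upTo (d + 2))) (trans (List.length-upTo (d + 2)) (initial-count d))
  where
  initial-count : ∀ d → d + 2 ≡ d + 2 + (d + 1) * 0
  initial-count = solve-∀
cliquesOf-wellFormed {d} {suc t} (cs ∷ʳ i) =
  subst (λ n → All (IsClique d n) (cliquesOf (cs ∷ʳ i))) (sym (ℕ.+-suc (d + 2) t))
        (All.++⁺ (All.map IsClique-weaken old-cliques)
                 (All.map⁺ (All.tabulate (IsClique-replace chosen-clique)))) ,
  (begin
    length (cliquesOf (cs ∷ʳ i))                     ≡⟨ List.length-++ (cliquesOf cs) ⟩
    length (cliquesOf cs) + length (map new chosen)  ≡⟨ cong₂ _+_ old-count (List.length-map new chosen) ⟩
    cliqueCount d t + length chosen                  ≡⟨ cong (cliqueCount d t +_) (size chosen-clique) ⟩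
    cliqueCount d t + suc d                          ≡⟨ cliqueCount-suc d t ⟨
    cliqueCount d (suc t)                            ∎)
  where
  open ≡-Reasoning
  old-cliques = proj₁ (cliquesOf-wellFormed cs)
  old-count   = proj₂ (cliquesOf-wellFormed cs)
  chosen = at (cliquesOf cs) (toℕ i)
  new : ℕ → List ℕ
  new x = d + 2 + t ∷ remove x chosen
  chosen-clique : IsClique d (d + 2 + t) chosen
  chosen-clique =
    All-at (cliquesOf cs) (toℕ i) old-cliques (subst (toℕ i ℕ.<_) (sym old-count) (Fin.toℕ<n i))

length-cliquesOf : ∀ {d t} (cs : Choices d t) → length (cliquesOf cs) ≡ cliqueCount d t
length-cliquesOf cs = proj₂ (cliquesOf-wellFormed cs)

-- Parallel degrees

steps-bounded : ∀ {d t} (cs : Choices d t) → All (ℕ._< cliqueCount d t) (steps cs)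
steps-bounded               []        = []
steps-bounded {d} {suc t}   (cs ∷ʳ i) =
  ℕ.<-≤-trans (Fin.toℕ<n i) growth ∷ All.map (λ s< → ℕ.<-≤-trans s< growth) (steps-bounded cs)
  where
  growth : cliqueCount d t ≤ cliqueCount d (suc t)
  growth = subst (cliqueCount d t ≤_) (sym (cliqueCount-suc d t)) (ℕ.m≤m+n _ _)

pdeg-fresh : ∀ {d t} (cs : Choices d t) j → cliqueCount d t ≤ j → pdeg cs j ≡ 0
pdeg-fresh cs j C≤j = cong length (List.filter-none (_≟ j)
  (All.map (λ s<C s≡j → ℕ.<-irrefl s≡j (ℕ.<-≤-trans s<C C≤j)) (steps-bounded cs)))

pdeg-∷ʳ-chosen : ∀ {d t} (cs : Choices d t) i → pdeg (cs ∷ʳ i) (toℕ i) ≡ suc (pdeg cs (toℕ i))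
pdeg-∷ʳ-chosen cs i = cong length (List.filter-accept (_≟ toℕ i) refl)

pdeg-∷ʳ-other : ∀ {d t} (cs : Choices d t) i {j} → j ≢ toℕ i → pdeg (cs ∷ʳ i) j ≡ pdeg cs j
pdeg-∷ʳ-other cs i j≢i = cong length (List.filter-reject (_≟ _) (j≢i ∘ sym))

Nc≡∑ : ∀ {d t} m (cs : Choices d t) → Nc m cs ≡ ∑[ j < cliqueCount d t ] 𝟙 (pdeg cs j ≟ m)
Nc≡∑ m cs = trans (length-filter≡sum-𝟙 (λ j → pdeg cs j ≟ m) (upTo (length (cliquesOf cs))))
                  (cong (λ n → ∑[ j < n ] 𝟙 (pdeg cs j ≟ m)) (length-cliquesOf cs))

Nc-∷ʳ : ∀ {d t} m (cs : Choices d t) i → let p = pdeg cs (toℕ i) in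
        Nc m (cs ∷ʳ i) + 𝟙 (p ≟ m) ≡ Nc m cs + 𝟙 (suc p ≟ m) + suc d * 𝟙 (0 ≟ m)
Nc-∷ʳ {d} {t} m cs i = begin
  Nc m (cs ∷ʳ i) + g (toℕ i)
    ≡⟨ cong (_+ g (toℕ i)) (trans (Nc≡∑ m (cs ∷ʳ i)) (cong (λ n → ∑< n f) (cliqueCount-suc d t))) ⟩
  ∑< (C + suc d) f + g (toℕ i)
    ≡⟨ cong (_+ g (toℕ i)) (∑-+ C (suc d) f) ⟩
  ∑< C f + ∑[ j < suc d ] f (C + j) + g (toℕ i)
    ≡⟨ cong (λ s → ∑< C f + s + g (toℕ i)) new-cliques ⟩
  ∑< C f + suc d * 𝟙 (0 ≟ m) + g (toℕ i)
    ≡⟨ swap (∑< C f) _ _ ⟩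
  ∑< C f + g (toℕ i) + suc d * 𝟙 (0 ≟ m)
    ≡⟨ cong (_+ suc d * 𝟙 (0 ≟ m)) (sum-map-update (Unique.upTo⁺ C) (∈-upTo⁺ (Fin.toℕ<n i)) old-cliques) ⟩
  ∑< C g + f (toℕ i) + suc d * 𝟙 (0 ≟ m)
    ≡⟨ cong₂ (λ s x → s + x + suc d * 𝟙 (0 ≟ m))
             (sym (Nc≡∑ m cs)) (cong (λ x → 𝟙 (x ≟ m)) (pdeg-∷ʳ-chosen cs i)) ⟩
  Nc m cs + 𝟙 (suc (pdeg cs (toℕ i)) ≟ m) + suc d * 𝟙 (0 ≟ m) ∎
  where
  open ≡-Reasoning
  C = cliqueCount d t
  f g : ℕ → ℕ
  f j = 𝟙 (pdeg (cs ∷ʳ i) j ≟ m)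
  g j = 𝟙 (pdeg cs j ≟ m)
  new-cliques : ∑[ j < suc d ] f (C + j) ≡ suc d * 𝟙 (0 ≟ m)
  new-cliques = trans (cong sum (List.map-cong (λ j → cong (λ x → 𝟙 (x ≟ m)) (fresh j)) (upTo (suc d))))
                      (∑-const (suc d) (𝟙 (0 ≟ m)))
    where
    fresh : ∀ j → pdeg (cs ∷ʳ i) (C + j) ≡ 0
    fresh j = trans (pdeg-∷ʳ-other cs i (λ C+j≡i → ℕ.<-irrefl (sym C+j≡i) (ℕ.<-≤-trans (Fin.toℕ<n i) C≤C+j)))
                    (pdeg-fresh cs (C + j) C≤C+j)
      where C≤C+j = ℕ.m≤m+n C j
  old-cliques : ∀ j → j ≢ toℕ i → f j ≡ g j
  old-cliques j j≢i = cong (λ x → 𝟙 (x ≟ m)) (pdeg-∷ʳ-other cs i j≢i)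
  swap : ∀ a b c → a + b + c ≡ a + c + b
  swap = solve-∀

NcPred : ∀ {d t} → ℕ → Choices d t → ℕ
NcPred zero    cs = 0
NcPred (suc m) cs = Nc m cs

∑-𝟙-suc-pdeg : ∀ {d t} m (cs : Choices d t) →
               ∑[ j < cliqueCount d t ] 𝟙 (suc (pdeg cs j) ≟ m) ≡ NcPred m cs
∑-𝟙-suc-pdeg {d} {t} zero    cs = trans (∑-const (cliqueCount d t) 0) (ℕ.*-zeroʳ (cliqueCount d t))
∑-𝟙-suc-pdeg         (suc m) cs = sym (Nc≡∑ m cs)

sum-Nc-children : ∀ {d t} m (cs : Choices d t) → let C = cliqueCount d t in
  sum (map (λ i → Nc m (cs ∷ʳ i)) (allFin C)) + Nc m cs ≡
  C * Nc m cs + NcPred m cs + C * (suc d * 𝟙 (0 ≟ m))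
sum-Nc-children {d} {t} m cs = begin
  sum (map (λ i → Nc m (cs ∷ʳ i)) (allFin C)) + Nc m cs
    ≡⟨ cong (sum (map (λ i → Nc m (cs ∷ʳ i)) (allFin C)) +_) (trans (Nc≡∑ m cs) (sym (sum-allFin C g))) ⟩
  sum (map (λ i → Nc m (cs ∷ʳ i)) (allFin C)) + sum (map (g ∘ toℕ) (allFin C))
    ≡⟨ sum-map-+ (λ i → Nc m (cs ∷ʳ i)) (g ∘ toℕ) (allFin C) ⟨
  sum (map (λ i → Nc m (cs ∷ʳ i) + g (toℕ i)) (allFin C))
    ≡⟨ cong sum (List.map-cong (Nc-∷ʳ m cs) (allFin C)) ⟩
  sum (map (λ i → Nc m cs + h (toℕ i) + K) (allFin C))
    ≡⟨ sum-map-+ (λ i → Nc m cs + h (toℕ i)) (const K) (allFin C) ⟩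
  sum (map (λ i → Nc m cs + h (toℕ i)) (allFin C)) + sum (map (const K) (allFin C))
    ≡⟨ cong₂ _+_ (sum-map-+ (const (Nc m cs)) (h ∘ toℕ) (allFin C)) (sum-map-const K (allFin C)) ⟩
  sum (map (const (Nc m cs)) (allFin C)) + sum (map (h ∘ toℕ) (allFin C)) + length (allFin C) * K
    ≡⟨ cong₂ (λ s n → s + sum (map (h ∘ toℕ) (allFin C)) + n * K)
             (trans (sum-map-const (Nc m cs) (allFin C)) (cong (_* Nc m cs) length-allFin))
             length-allFin ⟩
  C * Nc m cs + sum (map (h ∘ toℕ) (allFin C)) + C * K
    ≡⟨ cong (λ s → C * Nc m cs + s + C * K) (trans (sum-allFin C h) (∑-𝟙-suc-pdeg m cs)) ⟩
  C * Nc m cs + NcPred m cs + C * K ∎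
  where
  open ≡-Reasoning
  C = cliqueCount d t
  K = suc d * 𝟙 (0 ≟ m)
  g h : ℕ → ℕ
  g j = 𝟙 (pdeg cs j ≟ m)
  h j = 𝟙 (suc (pdeg cs j) ≟ m)
  length-allFin : length (allFin C) ≡ C
  length-allFin = List.length-tabulate (λ i → i)

-- Summing over all runs

totalNc : ℕ → ℕ → ℕ → ℕ
totalNc d t m = sum (map (Nc m) (allChoices d t))

runCount : ℕ → ℕ → ℕ
runCount d t = length (allChoices d t)

runCount-suc : ∀ d t → runCount d (suc t) ≡ runCount d t * cliqueCount d t
runCount-suc d t = length-concatMap _ children-count (allChoices d t)
  where
  children-count : ∀ cs → length (map (cs ∷ʳ_) (allFin (cliqueCount d t))) ≡ cliqueCount d t
  children-count cs = trans (List.length-map (cs ∷ʳ_) (allFin _)) (List.length-tabulate (λ i → i))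

totalNc-suc : ∀ d t m → let C = cliqueCount d t in
  totalNc d (suc t) m + totalNc d t m ≡
  C * totalNc d t m + sum (map (NcPred m) (allChoices d t)) +
  runCount d t * (C * (suc d * 𝟙 (0 ≟ m)))
totalNc-suc d t m = begin
  sum (map (Nc m) (concatMap children runs)) + sum (map (Nc m) runs)
    ≡⟨ cong (_+ sum (map (Nc m) runs)) (sum-map-concatMap (Nc m) children runs) ⟩
  sum (map (λ cs → sum (map (Nc m) (children cs))) runs) + sum (map (Nc m) runs)
    ≡⟨ sum-map-+ (λ cs → sum (map (Nc m) (children cs))) (Nc m) runs ⟨
  sum (map (λ cs → sum (map (Nc m) (children cs)) + Nc m cs) runs)
    ≡⟨ cong sum (List.map-cong per-run runs) ⟩
  sum (map (λ cs → C * Nc m cs + NcPred m cs + K) runs)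
    ≡⟨ sum-map-+ (λ cs → C * Nc m cs + NcPred m cs) (const K) runs ⟩
  sum (map (λ cs → C * Nc m cs + NcPred m cs) runs) + sum (map (const K) runs)
    ≡⟨ cong₂ _+_ (trans (sum-map-+ (λ cs → C * Nc m cs) (NcPred m) runs)
                        (cong (_+ sum (map (NcPred m) runs)) (sum-map-*ˡ C (Nc m) runs)))
                 (sum-map-const K runs) ⟩
  C * sum (map (Nc m) runs) + sum (map (NcPred m) runs) + runCount d t * K ∎
  where
  open ≡-Reasoning
  C = cliqueCount d t
  K = C * (suc d * 𝟙 (0 ≟ m))
  runs = allChoices d t
  children : Choices d t → List (Choices d (suc t))
  children cs = map (cs ∷ʳ_) (allFin C)
  per-run : ∀ cs → sum (map (Nc m) (children cs)) + Nc m cs ≡ C * Nc m cs + NcPred m cs + K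
  per-run cs = trans (cong (λ xs → sum xs + Nc m cs) (sym (List.map-∘ (allFin C))))
                     (sum-Nc-children m cs)

totalNc-suc-zero : ∀ d t →
  totalNc d (suc t) 0 ≡ (d + 1 + (d + 1) * t) * totalNc d t 0 + runCount d t * cliqueCount d t * suc d
totalNc-suc-zero d t = ℕ.+-cancelʳ-≡ S _ _ (begin
  totalNc d (suc t) 0 + S                                ≡⟨ totalNc-suc d t 0 ⟩
  C * S + sum (map (NcPred 0) runs) + R * (C * (suc d * 1))
    ≡⟨ cong (λ p → C * S + p + R * (C * (suc d * 1))) (trans (sum-map-const 0 runs) (ℕ.*-zeroʳ R)) ⟩
  C * S + 0 + R * (C * (suc d * 1))                      ≡⟨ polynomial d t S R ⟩
  (d + 1 + (d + 1) * t) * S + R * C * suc d + S          ∎)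
  where
  open ≡-Reasoning
  runs = allChoices d t
  C = cliqueCount d t
  R = runCount d t
  S = totalNc d t 0
  polynomial : ∀ d t s r → (d + 2 + (d + 1) * t) * s + 0 + r * ((d + 2 + (d + 1) * t) * (suc d * 1))
                         ≡ (d + 1 + (d + 1) * t) * s + r * (d + 2 + (d + 1) * t) * suc d + s
  polynomial = solve-∀

totalNc-suc-suc : ∀ d t m →
  totalNc d (suc t) (suc m) ≡ (d + 1 + (d + 1) * t) * totalNc d t (suc m) + totalNc d t m
totalNc-suc-suc d t m = ℕ.+-cancelʳ-≡ (totalNc d t (suc m)) _ _
  (trans (totalNc-suc d t (suc m))
         (polynomial d t (totalNc d t (suc m)) (totalNc d t m) (runCount d t)))
  where
  polynomial : ∀ d t s s′ r → (d + 2 + (d + 1) * t) * s + s′ + r * ((d + 2 + (d + 1) * t) * (suc d * 0))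
                            ≡ (d + 1 + (d + 1) * t) * s + s′ + s
  polynomial = solve-∀

-- The error bound

∣-∣-linear : ∀ a b x₁ y₁ x₂ y₂ →
             ℕ.∣ a * x₁ + b * x₂ - a * y₁ + b * y₂ ∣ ≤ a * ℕ.∣ x₁ - y₁ ∣ + b * ℕ.∣ x₂ - y₂ ∣
∣-∣-linear a b x₁ y₁ x₂ y₂ = begin
  ℕ.∣ a * x₁ + b * x₂ - a * y₁ + b * y₂ ∣
    ≤⟨ ℕ.∣-∣-triangle (a * x₁ + b * x₂) (a * y₁ + b * x₂) _ ⟩
  ℕ.∣ a * x₁ + b * x₂ - a * y₁ + b * x₂ ∣ + ℕ.∣ a * y₁ + b * x₂ - a * y₁ + b * y₂ ∣
    ≡⟨ cong₂ _+_ (trans (cong₂ ℕ.∣_-_∣ (ℕ.+-comm (a * x₁) _) (ℕ.+-comm (a * y₁) _))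
                        (ℕ.∣m+n-m+o∣≡∣n-o∣ (b * x₂) _ _))
                 (ℕ.∣m+n-m+o∣≡∣n-o∣ (a * y₁) _ _) ⟩
  ℕ.∣ a * x₁ - a * y₁ ∣ + ℕ.∣ b * x₂ - b * y₂ ∣
    ≡⟨ cong₂ _+_ (ℕ.*-distribˡ-∣-∣ a x₁ y₁) (ℕ.*-distribˡ-∣-∣ b x₂ y₂) ⟨
  a * ℕ.∣ x₁ - y₁ ∣ + b * ℕ.∣ x₂ - y₂ ∣ ∎
  where open ℕ.≤-Reasoning

∣-∣-linear-≤ : ∀ a b {x y x₁ y₁ x₂ y₂ e₁ e₂ e} →
               x ≡ a * x₁ + b * x₂ → y ≡ a * y₁ + b * y₂ → a * e₁ + b * e₂ ≤ e →
               ℕ.∣ x₁ - y₁ ∣ ≤ e₁ → ℕ.∣ x₂ - y₂ ∣ ≤ e₂ → ℕ.∣ x - y ∣ ≤ e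
∣-∣-linear-≤ a b {x₁ = x₁} {y₁} {x₂} {y₂} refl refl e-bound ≤e₁ ≤e₂ = begin
  ℕ.∣ a * x₁ + b * x₂ - a * y₁ + b * y₂ ∣   ≤⟨ ∣-∣-linear a b x₁ y₁ x₂ y₂ ⟩
  a * ℕ.∣ x₁ - y₁ ∣ + b * ℕ.∣ x₂ - y₂ ∣      ≤⟨ ℕ.+-mono-≤ (ℕ.*-monoʳ-≤ a ≤e₁) (ℕ.*-monoʳ-≤ b ≤e₂) ⟩
  _                                          ≤⟨ e-bound ⟩
  _                                          ∎
  where open ℕ.≤-Reasoning

+2-nonZero : ∀ d → NonZero (d + 2)
+2-nonZero d = ℕ.≢-nonZero (ℕ.m+1+n≢0 d)

totalNc-initial : ∀ d m → totalNc d 0 m ≡ cliqueCount d 0 * 𝟙 (0 ≟ m)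
totalNc-initial d m = trans (ℕ.+-identityʳ (Nc m empty))
                            (trans (Nc≡∑ m empty) (∑-const (cliqueCount d 0) (𝟙 (0 ≟ m))))
  where
  empty : Choices d 0
  empty = []

-- In terms of expectations: |E[Nc t m] / C - (d + 1) / Q| ≤ 1 / C, where C = cliqueCount d t.
totalNc-deviation : ∀ d t m → let Q = (d + 2) ^ (m + 1) in
  ℕ.∣ totalNc d t m * Q - (d + 1) * (runCount d t * cliqueCount d t) ∣ ≤ runCount d t * Q
totalNc-deviation d zero zero = ℕ.≤-reflexive (begin
  ℕ.∣ totalNc d 0 0 * ((d + 2) * 1) - Y ∣
    ≡⟨ cong (λ n → ℕ.∣ n * ((d + 2) * 1) - Y ∣) (totalNc-initial d 0) ⟩
  ℕ.∣ C₀ * 1 * ((d + 2) * 1) - Y ∣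
    ≡⟨ cong (ℕ.∣_- Y ∣) (polynomial d) ⟩
  ℕ.∣ Y + (d + 2) - Y ∣
    ≡⟨ trans (ℕ.∣-∣-comm (Y + (d + 2)) Y) (ℕ.∣m-m+n∣≡n Y (d + 2)) ⟩
  d + 2
    ≡⟨ trans (ℕ.*-identityˡ _) (ℕ.*-identityʳ (d + 2)) ⟨
  1 * ((d + 2) * 1) ∎)
  where
  open ≡-Reasoning
  C₀ = cliqueCount d 0
  Y = (d + 1) * (1 * C₀)
  polynomial : ∀ d → (d + 2 + (d + 1) * 0) * 1 * ((d + 2) * 1) ≡
                     (d + 1) * (1 * (d + 2 + (d + 1) * 0)) + (d + 2)
  polynomial = solve-∀
totalNc-deviation d zero (suc j) = begin
  ℕ.∣ totalNc d 0 (suc j) * Q - Y ∣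
    ≡⟨ cong (λ n → ℕ.∣ n * Q - Y ∣) (trans (totalNc-initial d (suc j)) (ℕ.*-zeroʳ C₀)) ⟩
  ℕ.∣ 0 - Y ∣                   ≡⟨ ℕ.∣-∣-identityˡ Y ⟩
  (d + 1) * (1 * C₀)            ≤⟨ ℕ.m≤m+n _ (d + 2) ⟩
  (d + 1) * (1 * C₀) + (d + 2)  ≡⟨ polynomial d ⟩
  (d + 2) * (d + 2) ^ 1         ≤⟨ ℕ.*-monoʳ-≤ (d + 2) (ℕ.^-monoʳ-≤ (d + 2) {{+2-nonZero d}} (ℕ.m≤n+m 1 j)) ⟩
  (d + 2) * (d + 2) ^ (j + 1)   ≡⟨ ℕ.*-identityˡ Q ⟨
  1 * Q                         ∎
  where
  open ℕ.≤-Reasoning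
  C₀ = cliqueCount d 0
  Y = (d + 1) * (1 * C₀)
  Q = (d + 2) ^ (suc j + 1)
  polynomial : ∀ d → (d + 1) * (1 * (d + 2 + (d + 1) * 0)) + (d + 2) ≡ (d + 2) * ((d + 2) * 1)
  polynomial = solve-∀
totalNc-deviation d (suc t) zero rewrite runCount-suc d t =
  ∣-∣-linear-≤ (d + 1 + (d + 1) * t) 1
    (trans (cong (_* ((d + 2) * 1)) (totalNc-suc-zero d t)) (x-polynomial d t (totalNc d t 0) R))
    (y-polynomial d t R)
    (ℕ.≤-trans (ℕ.m≤m+n _ (R * ((d + 2) * 1))) (ℕ.≤-reflexive (e-polynomial d t R)))
    (totalNc-deviation d t 0)
    (ℕ.≤-reflexive (ℕ.∣n-n∣≡0 ((d + 1) * (R * cliqueCount d t) * (d + 2))))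
  where
  R = runCount d t
  x-polynomial : ∀ d t s r →
    ((d + 1 + (d + 1) * t) * s + r * (d + 2 + (d + 1) * t) * suc d) * ((d + 2) * 1) ≡
    (d + 1 + (d + 1) * t) * (s * ((d + 2) * 1)) +
    1 * ((d + 1) * (r * (d + 2 + (d + 1) * t)) * (d + 2))
  x-polynomial = solve-∀
  y-polynomial : ∀ d t r →
    (d + 1) * (r * (d + 2 + (d + 1) * t) * (d + 2 + (d + 1) * suc t)) ≡
    (d + 1 + (d + 1) * t) * ((d + 1) * (r * (d + 2 + (d + 1) * t))) +
    1 * ((d + 1) * (r * (d + 2 + (d + 1) * t)) * (d + 2))
  y-polynomial = solve-∀
  e-polynomial : ∀ d t r →
    (d + 1 + (d + 1) * t) * (r * ((d + 2) * 1)) + 1 * 0 + r * ((d + 2) * 1) ≡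
    r * (d + 2 + (d + 1) * t) * ((d + 2) * 1)
  e-polynomial = solve-∀
totalNc-deviation d (suc t) (suc j) rewrite runCount-suc d t =
  ∣-∣-linear-≤ (d + 1 + (d + 1) * t) (d + 2)
    (trans (cong (_* ((d + 2) * q)) (totalNc-suc-suc d t j))
           (x-polynomial d t (totalNc d t (suc j)) (totalNc d t j) q))
    (y-polynomial d t (runCount d t))
    (ℕ.≤-reflexive (e-polynomial d t (runCount d t) q))
    (totalNc-deviation d t (suc j))
    (totalNc-deviation d t j)
  where
  q = (d + 2) ^ (j + 1)
  x-polynomial : ∀ d t s s′ q →
    ((d + 1 + (d + 1) * t) * s + s′) * ((d + 2) * q) ≡
    (d + 1 + (d + 1) * t) * (s * ((d + 2) * q)) + (d + 2) * (s′ * q)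
  x-polynomial = solve-∀
  y-polynomial : ∀ d t r →
    (d + 1) * (r * (d + 2 + (d + 1) * t) * (d + 2 + (d + 1) * suc t)) ≡
    (d + 1 + (d + 1) * t) * ((d + 1) * (r * (d + 2 + (d + 1) * t))) +
    (d + 2) * ((d + 1) * (r * (d + 2 + (d + 1) * t)))
  y-polynomial = solve-∀
  e-polynomial : ∀ d t r q →
    (d + 1 + (d + 1) * t) * (r * ((d + 2) * q)) + (d + 2) * (r * q) ≡
    r * (d + 2 + (d + 1) * t) * ((d + 2) * q)
  e-polynomial = solve-∀

-- From ℕ to ℚ

∣+m-+n∣≡∣m-n∣ : ∀ m n → ℤ.∣ ℤ.+ m ℤ.- ℤ.+ n ∣ ≡ ℕ.∣ m - n ∣
∣+m-+n∣≡∣m-n∣ m n rewrite ℤ.m-n≡m⊖n m n with ℕ.≤-total m n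
... | inj₁ m≤n = trans (ℤ.∣⊖∣-≤ m≤n) (sym (ℕ.m≤n⇒∣m-n∣≡n∸m m≤n))
... | inj₂ n≤m = trans (ℤ.∣m⊖n∣≡∣n⊖m∣ m n) (trans (ℤ.∣⊖∣-≤ n≤m) (sym (ℕ.m≤n⇒∣n-m∣≡n∸m n≤m)))

∣frac-frac∣≃ : ∀ x y n₁ n₂ → let D = ℕ.∣ x * suc n₂ - y * suc n₁ ∣ in
  toℚᵘ ∣ frac x (suc n₁) - frac y (suc n₂) ∣ ℚᵘ.≃ mkℚᵘ (ℤ.+ D) (ℕ.pred (suc n₁ * suc n₂))
∣frac-frac∣≃ x y n₁ n₂ = begin
  toℚᵘ ∣ p - q ∣
    ≡⟨ toℚᵘ-∣∣ (p - q) ⟩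
  ℚᵘ.∣ toℚᵘ (p - q) ∣
    ≈⟨ ℚᵘ.∣-∣-cong (ℚᵘ.≃-trans (ℚ.toℚᵘ-homo-+ p (ℚ.- q))
                               (ℚᵘ.+-cong (ℚ.toℚᵘ-fromℚᵘ (mkℚᵘ (ℤ.+ x) n₁))
                                          (ℚᵘ.≃-trans (ℚ.toℚᵘ-homo‿- q)
                                                      (ℚᵘ.-‿cong (ℚ.toℚᵘ-fromℚᵘ (mkℚᵘ (ℤ.+ y) n₂)))))) ⟩
  ℚᵘ.∣ mkℚᵘ (ℤ.+ x) n₁ ℚᵘ.- mkℚᵘ (ℤ.+ y) n₂ ∣
    ≡⟨ cong (λ n → mkℚᵘ (ℤ.+ n) (ℕ.pred (suc n₁ * suc n₂))) numerator ⟩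
  mkℚᵘ (ℤ.+ ℕ.∣ x * suc n₂ - y * suc n₁ ∣) (ℕ.pred (suc n₁ * suc n₂)) ∎
  where
  open ℚᵘ.≃-Reasoning
  p = frac x (suc n₁)
  q = frac y (suc n₂)
  toℚᵘ-∣∣ : ∀ r → toℚᵘ ∣ r ∣ ≡ ℚᵘ.∣ toℚᵘ r ∣
  toℚᵘ-∣∣ (mkℚ _ _ _) = refl
  numerator : ℤ.∣ ℤ.+ x ℤ.* ℤ.+ suc n₂ ℤ.+ ℤ.- (ℤ.+ y) ℤ.* ℤ.+ suc n₁ ∣ ≡ ℕ.∣ x * suc n₂ - y * suc n₁ ∣
  numerator = trans (cong ℤ.∣_∣ (cong₂ ℤ._+_ (sym (ℤ.pos-* x (suc n₂)))
                                             (trans (sym (ℤ.neg-distribˡ-* (ℤ.+ y) (ℤ.+ suc n₁)))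
                                                    (cong ℤ.-_ (sym (ℤ.pos-* y (suc n₁)))))))
                    (∣+m-+n∣≡∣m-n∣ (x * suc n₂) (y * suc n₁))

frac-distance< : ∀ {x y D₁ D₂ e} .{{_ : NonZero D₁}} .{{_ : NonZero D₂}}
                 a b .(c : Coprime (suc a) (suc b)) →
  ℕ.∣ x * D₂ - y * D₁ ∣ ≤ e → e * suc b ℕ.< suc a * (D₁ * D₂) →
  ∣ frac x D₁ - frac y D₂ ∣ < mkℚ +[1+ a ] b c
frac-distance< {x} {y} {suc n₁} {suc n₂} a b c D≤e e< =
  ℚ.toℚᵘ-cancel-< (ℚᵘ.<-respˡ-≃ (ℚᵘ.≃-sym (∣frac-frac∣≃ x y n₁ n₂))
    (ℚᵘ.*<* (subst₂ ℤ._<_ (ℤ.pos-* ℕ.∣ x * suc n₂ - y * suc n₁ ∣ (suc b))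
                          (ℤ.pos-* (suc a) (suc n₁ * suc n₂))
                          (ℤ.+<+ (ℕ.≤-<-trans (ℕ.*-monoˡ-≤ (suc b) D≤e) e<)))))

t<cliqueCount : ∀ d t → t ℕ.< cliqueCount d t
t<cliqueCount d t = ℕ.≤-trans (ℕ.m≤m+n (suc t) (d + 1 + d * t)) (ℕ.≤-reflexive (polynomial d t))
  where
  polynomial : ∀ d t → suc t + (d + 1 + d * t) ≡ d + 2 + (d + 1) * t
  polynomial = solve-∀

cliqueCount-nonZero : ∀ d t → NonZero (cliqueCount d t)
cliqueCount-nonZero d t = ℕ.>-nonZero (ℕ.≤-<-trans z≤n (t<cliqueCount d t))

runCount-nonZero : ∀ d t → NonZero (runCount d t)
runCount-nonZero d zero    = _
runCount-nonZero d (suc t) = subst NonZero (sym (runCount-suc d t))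
  (ℕ.m*n≢0 (runCount d t) (cliqueCount d t) {{runCount-nonZero d t}} {{cliqueCount-nonZero d t}})

scaled-< : ∀ r q {k n} a .{{_ : NonZero r}} .{{_ : NonZero q}} →
           k ℕ.< n → r * q * k ℕ.< suc a * (r * n * q)
scaled-< r q {k} {n} a k<n = begin-strict
  r * q * k            <⟨ ℕ.*-monoʳ-< (r * q) {{ℕ.m*n≢0 r q}} k<n ⟩
  r * q * n            ≡⟨ ℕ.*-assoc r q n ⟩
  r * (q * n)          ≡⟨ cong (r *_) (ℕ.*-comm q n) ⟩
  r * (n * q)          ≡⟨ ℕ.*-assoc r n q ⟨
  r * n * q            ≤⟨ ℕ.m≤n*m (r * n * q) (suc a) ⟩
  suc a * (r * n * q)  ∎
  where open ℕ.≤-Reasoning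

normExpNc-close : ∀ d m t a b .(c : Coprime (suc a) (suc b)) → t ≥ suc b →
  ∣ normExpNc d t m - frac (d + 1) ((d + 2) ^ (m + 1)) ∣ < mkℚ +[1+ a ] b c
normExpNc-close d m t a b c t≥1+b =
  frac-distance< {totalNc d t m} {d + 1} {R * C} {Q} a b c
    (totalNc-deviation d t m) (scaled-< R Q a (ℕ.≤-<-trans t≥1+b (t<cliqueCount d t)))
  where
  R = runCount d t
  C = cliqueCount d t
  Q = (d + 2) ^ (m + 1)
  instance
    R≢0  = runCount-nonZero d t
    Q≢0  = ℕ.m^n≢0 (d + 2) (m + 1) {{+2-nonZero d}}
    RC≢0 = ℕ.m*n≢0 R C {{R≢0}} {{cliqueCount-nonZero d t}}

mainTheorem1 : (d : ℕ) → 1 ≤ d → (m : ℕ) → (ε : ℚ) → 0ℚ < ε →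
    ∃ λ T → (t : ℕ) → t ≥ T →
      ∣ normExpNc d t m - frac (d + 1) ((d + 2) ^ (m + 1)) ∣ < ε
mainTheorem1 d _ m (mkℚ +[1+ a ] b c) _ = suc b , λ t → normExpNc-close d m t a b c
mainTheorem1 d _ m (mkℚ (ℤ.+ 0) b c) (ℚ.*<* (ℤ.+<+ ()))
mainTheorem1 d _ m (mkℚ -[1+ a ] b c) (ℚ.*<* ())
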